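{- For all $r,n\ge 1$, \[\sum_{g\in G_{r,n}} csign_F(g)\,q^{\text{flag-major}_F(g)}=[r]_{ -q}^{\,n}\,[n]_{\pm q^r}!.\]
   Context: $G_{r,n}$ is the set of pairs $g=(z,\pi)$ with $z\in\{0,\dots,r-1\}^n$, $\pi\in S_n$ (the wreath product $C_r\wr S_n$). To $g$ associate the word $\pi(1)^{[z_1]}\cdots\pi(n)^{[z_n]}$ over the alphabet $\{i^{[c]}:1\le i\le n,0\le c\le r-1\}$, ordered by the friends order $F$: $1^{[r-1]}<\dots<1^{[1]}<1^{[0]}<2^{[r-1]}<\dots<2^{[0]}<\dots<n^{[r-1]}<\dots<n^{[0]}$. Then $Des_F(g)=\{1\le i\le n-1:\pi(i)^{[z_i]}>_F\pi(i+1)^{[z_{i+1}]}\}$, $maj_F(g)=\sum_{i\in Des_F(g)}i$, $inv_F(g)=|\{i<j:\pi(i)^{[z_i]}>_F\pi(j)^{[z_j]}\}|$, $csum(g)=\sum_i z_i$, $\text{flag-major}_F(g)=r\,maj_F(g)+csum(g)$, and $csign_F(g)=(-1)^{inv_F(g)+csum(g)}$. Notation: $[k]_x=\frac{1-x^k}{1-x}$, $[n]_{\pm x}!=[1]_x[2]_{ -x}[3]_x\cdots[n]_{(-1)^{n-1}x}$. -}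

module Defs where

open import Level using (Level)
open import Data.Nat as ℕ using (ℕ; zero; suc; _∸_; _<ᵇ_)
open import Data.Bool using (Bool; true; false; if_then_else_; _∧_; not)
open import Data.Fin as Fin using (Fin; toℕ)
open import Data.Vec as Vec using (Vec; []; _∷_)
open import Data.List as List using (List; []; _∷_; concatMap; map)
open import Data.Product using (_×_; _,_; proj₁; proj₂)
open import Algebra.Bundles using (CommutativeRing)

allVecs : (k n : ℕ) → List (Vec (Fin k) n)
allVecs k zero    = Vec.[] ∷ []
allVecs k (suc n) = concatMap (λ a → map (a Vec.∷_) (allVecs k n)) (List.allFin k)

boolFilter : {A : Set} → (A → Bool) → List A → List A
boolFilter p []       = []
boolFilter p (x ∷ xs) = if p x then x ∷ boolFilter p xs else boolFilter p xs

elemᵇ : ∀ {m k} → Fin m → Vec (Fin m) k → Bool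
elemᵇ a []       = false
elemᵇ a (b ∷ bs) = if toℕ a ℕ.≡ᵇ toℕ b then true else elemᵇ a bs

distinctᵇ : ∀ {m k} → Vec (Fin m) k → Bool
distinctᵇ []       = true
distinctᵇ (a ∷ as) = not (elemᵇ a as) ∧ distinctᵇ as

-- Elements of S_n in one-line notation: π = (π(1),…,π(n)) (values 0-based).
Perms : (n : ℕ) → List (Vec (Fin n) n)
Perms n = boolFilter distinctᵇ (allVecs n n)

-- G_{r,n} = C_r ≀ S_n as pairs (z , π).
G : (r n : ℕ) → List (Vec (Fin r) n × Vec (Fin n) n)
G r n = concatMap (λ z → map (z ,_) (Perms n)) (allVecs r n)

-- A letter i^[c] is stored as the pair (i , c) (i 0-based).
Letter : Set
Letter = ℕ × ℕ

-- Position of a letter in the friends order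
-- 1^[r-1] < … < 1^[0] < 2^[r-1] < … < 2^[0] < … (for the colour bound r).
fkey : ℕ → Letter → ℕ
fkey r (i , c) = i ℕ.* r ℕ.+ (r ∸ 1 ∸ c)

_>F[_]_ : Letter → ℕ → Letter → Bool
a >F[ r ] b = fkey r b <ᵇ fkey r a

word : ∀ {r n} → Vec (Fin r) n × Vec (Fin n) n → List Letter
word (z , π) = Vec.toList (Vec.zipWith (λ p c → (toℕ p , toℕ c)) π z)

majFrom : ℕ → ℕ → List Letter → ℕ
majFrom r k []           = 0
majFrom r k (a ∷ [])     = 0
majFrom r k (a ∷ b ∷ w)  =
  (if a >F[ r ] b then k else 0) ℕ.+ majFrom r (suc k) (b ∷ w)

majF : ∀ {r n} → Vec (Fin r) n × Vec (Fin n) n → ℕ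
majF {r} g = majFrom r 1 (word g)

invList : ℕ → List Letter → ℕ
invList r []      = 0
invList r (a ∷ w) = List.length (boolFilter (λ b → a >F[ r ] b) w) ℕ.+ invList r w

invF : ∀ {r n} → Vec (Fin r) n × Vec (Fin n) n → ℕ
invF {r} g = invList r (word g)

csum : ∀ {r n} → Vec (Fin r) n × Vec (Fin n) n → ℕ
csum (z , π) = List.foldr ℕ._+_ 0 (List.map toℕ (Vec.toList z))

flagMajorF : ∀ {r n} → Vec (Fin r) n × Vec (Fin n) n → ℕ
flagMajorF {r} g = r ℕ.* majF g ℕ.+ csum g

module RingNotions {c ℓ : Level} (R : CommutativeRing c ℓ) where
  open CommutativeRing R

  infixr 8 _^'_
  _^'_ : Carrier → ℕ → Carrier
  x ^' zero  = 1#
  x ^' suc k = x * (x ^' k)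

  sgn : ℕ → Carrier
  sgn zero    = 1#
  sgn (suc k) = - (sgn k)

  csignF : ∀ {r n} → Vec (Fin r) n × Vec (Fin n) n → Carrier
  csignF g = sgn (invF g ℕ.+ csum g)

  ΣL : {A : Set} → List A → (A → Carrier) → Carrier
  ΣL []       f = 0#
  ΣL (a ∷ as) f = f a + ΣL as f

  qint : ℕ → Carrier → Carrier
  qint zero    x = 0#
  qint (suc k) x = 1# + x * qint k x

  qfact± : ℕ → Carrier → Carrier
  qfact± zero    x = 1#
  qfact± (suc n) x = qfact± n x * qint (suc n) (sgn n * x)

  LHS : ℕ → ℕ → Carrier → Carrier
  LHS r n q = ΣL (G r n) (λ g → csignF g * (q ^' flagMajorF g))

  RHS : ℕ → ℕ → Carrier → Carrier
  RHS r n q = (qint r (- q) ^' n) * qfact± n (q ^' r)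

{-# OPTIONS --safe #-}
-- For g = (z , π) the letters π(i)^[z_i] have pairwise distinct values, so the friends
-- order compares them by value alone: inv_F g = inv π and maj_F g = maj π.  The summand
-- therefore factors as (-q)^csum(z) · (-1)^inv(π) (q^r)^maj(π), and the sum splits into
-- Σ_z (-q)^csum(z) = [r]_{-q}^n and the signed Mahonian sum Σ_{π ∈ S_n} (-1)^inv(π) x^maj(π)
-- at x = q^r.  For the latter, write π ∈ S_{n+1} as σ ∈ S_n, shifted past a, followed by
-- the last letter a: this adds n - a inversions, and adds n to maj iff a ≤ last σ.  Refining
-- by the last letter, Σ_{last π = j} (-1)^inv(π) x^maj(π) = [n]_{±x}! ((-1)^n x)^(n-j)
-- follows by induction, the sum over the last letter of σ being a rotated geometric sum;
-- summing over j gives the next factor [n+1]_{(-1)^n x}.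
module Submission where

open import Defs
open import Level using (Level)
open import Data.Nat using (ℕ; _≤_)
open import Algebra.Bundles using (CommutativeRing)

open import Function using (_∘_; id)
open import Data.Nat using (zero; suc; _∸_; _<_; _<ᵇ_; _≤ᵇ_; _≡ᵇ_)
open import Data.Bool using (Bool; true; false; if_then_else_; not; _∧_; _∨_; T)
open import Data.Bool.Properties using (∧-identityʳ; ∧-zeroʳ)
open import Data.Fin as Fin using (Fin; zero; suc; toℕ; punchIn)
open import Data.Fin.Properties using (toℕ<n; toℕ≤pred[n])
open import Data.List as List using (List; []; _∷_; _++_; concatMap)
open import Data.Nat.ListAction using (sum)
open import Data.List.Properties using (map-tabulate; length-tabulate; map-id)
open import Data.List.Relation.Unary.All as All using (All; []; _∷_)
open import Data.List.Relation.Unary.AllPairs using (AllPairs; []; _∷_)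
open import Data.Vec as Vec using (Vec; []; _∷_; _∷ʳ_)
open import Data.Vec.Properties using (toList-map; toList-∷ʳ; last-∷ʳ; length-toList)
open import Data.Product using (_×_; _,_; proj₁; proj₂)
open import Relation.Binary.PropositionalEquality using (_≡_; _≢_)

-- ℕ's _+_ and _*_ are opened only in this block; in the module Sums they are the ring's.
module _ where
  open import Data.Nat using (_+_; _*_; z≤n; s≤s)
  open import Data.Nat.Properties
    using ( _<?_; _≤?_; <-cmp; ≤⇒≯; <⇒≱; <⇒≤; m∸n≤m; +-monoʳ-<; +-comm; +-assoc; +-suc; *-monoˡ-≤
          ; m≤m+n; m≤n⇒m≤1+n; +-identityʳ; 0∸n≡0; +-cancelˡ-≡; n≤0⇒n≡0; ≤-trans; ≤-reflexive; ≡⇒≡ᵇ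
          ; +-commutativeSemigroup; module ≤-Reasoning)
  open import Relation.Binary.PropositionalEquality
    using (refl; sym; trans; cong; cong₂; subst; module ≡-Reasoning)
  open import Relation.Binary.Definitions using (tri<; tri≈; tri>)
  open import Relation.Nullary.Decidable using (dec-true; dec-false)
  open import Relation.Nullary.Negation using (contradiction)
  open import Algebra.Properties.CommutativeSemigroup +-commutativeSemigroup
    using (interchange; x∙yz≈y∙xz; xy∙z≈y∙xz)

  _>ᵇ_ : ℕ → ℕ → Bool
  m >ᵇ n = n <ᵇ m

  _>ᶠ_ : ∀ {m} → Fin m → Fin m → Bool
  i >ᶠ j = toℕ i >ᵇ toℕ j

  ⟦_⟧ : Bool → ℕ
  ⟦ b ⟧ = if b then 1 else 0

  <ᵇ-true : ∀ {m n} → m < n → (m <ᵇ n) ≡ true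
  <ᵇ-true {m} {n} = dec-true (m <? n)

  <ᵇ-false : ∀ {m n} → n ≤ m → (m <ᵇ n) ≡ false
  <ᵇ-false {m} {n} n≤m = dec-false (m <? n) (≤⇒≯ n≤m)

  ≤ᵇ-true : ∀ {m n} → m ≤ n → (m ≤ᵇ n) ≡ true
  ≤ᵇ-true {m} {n} = dec-true (m ≤? n)

  ≤ᵇ-false : ∀ {m n} → n < m → (m ≤ᵇ n) ≡ false
  ≤ᵇ-false {m} {n} n<m = dec-false (m ≤? n) (<⇒≱ n<m)

  <ᵇ-suc : ∀ m n → (m <ᵇ suc n) ≡ (m ≤ᵇ n)
  <ᵇ-suc zero    n = refl
  <ᵇ-suc (suc m) n = refl

  ≡ᵇ-sym : ∀ m n → (m ≡ᵇ n) ≡ (n ≡ᵇ m)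
  ≡ᵇ-sym zero    zero    = refl
  ≡ᵇ-sym zero    (suc n) = refl
  ≡ᵇ-sym (suc m) zero    = refl
  ≡ᵇ-sym (suc m) (suc n) = ≡ᵇ-sym m n

  ≡ᵇ-false⇒≢ : ∀ {m n} → (m ≡ᵇ n) ≡ false → m ≢ n
  ≡ᵇ-false⇒≢ {m} m≢ᵇm refl = subst T m≢ᵇm (≡⇒≡ᵇ m m refl)

  fkey-< : ∀ {r i j} c d → c < r → i < j → fkey r (i , c) < fkey r (j , d)
  fkey-< {suc r} {i} {j} c d _ i<j = begin-strict
    i * suc r + (r ∸ c)   <⟨ +-monoʳ-< (i * suc r) (s≤s (m∸n≤m r c)) ⟩
    i * suc r + suc r     ≡⟨ +-comm (i * suc r) (suc r) ⟩
    suc i * suc r         ≤⟨ *-monoˡ-≤ (suc r) i<j ⟩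
    j * suc r             ≤⟨ m≤m+n (j * suc r) _ ⟩
    fkey (suc r) (j , d)  ∎
    where open ≤-Reasoning

  >F-distinct-values : ∀ {r i j c d} → c < r → d < r → i ≢ j → ((i , c) >F[ r ] (j , d)) ≡ (i >ᵇ j)
  >F-distinct-values {i = i} {j} {c} {d} c<r d<r i≢j with <-cmp i j
  ... | tri< i<j _ _ = trans (<ᵇ-false (<⇒≤ (fkey-< c d c<r i<j))) (sym (<ᵇ-false (<⇒≤ i<j)))
  ... | tri≈ _ i≡j _ = contradiction i≡j i≢j
  ... | tri> _ _ j<i = trans (<ᵇ-true (fkey-< d c d<r j<i)) (sym (<ᵇ-true j<i))

  punchIn-<ᵇ : ∀ {m} (a : Fin (suc m)) (i j : Fin m) →
    (toℕ (punchIn a i) <ᵇ toℕ (punchIn a j)) ≡ (toℕ i <ᵇ toℕ j)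
  punchIn-<ᵇ zero    i       j       = refl
  punchIn-<ᵇ (suc a) zero    zero    = refl
  punchIn-<ᵇ (suc a) zero    (suc j) = refl
  punchIn-<ᵇ (suc a) (suc i) zero    = refl
  punchIn-<ᵇ (suc a) (suc i) (suc j) = punchIn-<ᵇ a i j

  punchIn-≡ᵇ : ∀ {m} (a : Fin (suc m)) (i j : Fin m) →
    (toℕ (punchIn a i) ≡ᵇ toℕ (punchIn a j)) ≡ (toℕ i ≡ᵇ toℕ j)
  punchIn-≡ᵇ zero    i       j       = refl
  punchIn-≡ᵇ (suc a) zero    zero    = refl
  punchIn-≡ᵇ (suc a) zero    (suc j) = refl
  punchIn-≡ᵇ (suc a) (suc i) zero    = refl
  punchIn-≡ᵇ (suc a) (suc i) (suc j) = punchIn-≡ᵇ a i j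

  <ᵇ-punchIn : ∀ {m} (a : Fin (suc m)) (j : Fin m) → (toℕ a <ᵇ toℕ (punchIn a j)) ≡ (toℕ a ≤ᵇ toℕ j)
  <ᵇ-punchIn zero    j       = refl
  <ᵇ-punchIn (suc a) zero    = refl
  <ᵇ-punchIn (suc a) (suc j) = trans (<ᵇ-punchIn a j) (sym (<ᵇ-suc (toℕ a) (toℕ j)))

  -- Descents and inversions of a word

  module _ {A : Set} where

    count : (A → Bool) → List A → ℕ
    count p xs = List.length (boolFilter p xs)

    maj : (A → A → Bool) → ℕ → List A → ℕ
    maj _≻_ k []          = 0
    maj _≻_ k (a ∷ [])    = 0
    maj _≻_ k (a ∷ b ∷ w) = (if a ≻ b then k else 0) + maj _≻_ (suc k) (b ∷ w)

    inv : (A → A → Bool) → List A → ℕ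
    inv _≻_ []      = 0
    inv _≻_ (a ∷ w) = count (a ≻_) w + inv _≻_ w

    count-∷ : ∀ p (x : A) xs → count p (x ∷ xs) ≡ ⟦ p x ⟧ + count p xs
    count-∷ p x xs with p x
    ... | true  = refl
    ... | false = refl

    count-∷ʳ : ∀ p (xs : List A) c → count p (xs List.∷ʳ c) ≡ count p xs + ⟦ p c ⟧
    count-∷ʳ p []       c = trans (count-∷ p c []) (+-identityʳ ⟦ p c ⟧)
    count-∷ʳ p (x ∷ xs) c with p x
    ... | true  = cong suc (count-∷ʳ p xs c)
    ... | false = count-∷ʳ p xs c

    count-true : ∀ (xs : List A) → count (λ _ → true) xs ≡ List.length xs
    count-true []       = refl
    count-true (x ∷ xs) = cong suc (count-true xs)

    count-∧-≤ : ∀ (p q : A → Bool) xs → count (λ x → p x ∧ q x) xs ≤ count q xs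
    count-∧-≤ p q []       = z≤n
    count-∧-≤ p q (x ∷ xs) with p x | q x
    ... | true  | true  = s≤s (count-∧-≤ p q xs)
    ... | true  | false = count-∧-≤ p q xs
    ... | false | true  = m≤n⇒m≤1+n (count-∧-≤ p q xs)
    ... | false | false = count-∧-≤ p q xs

  majFrom≡maj : ∀ r k w → majFrom r k w ≡ maj (_>F[ r ]_) k w
  majFrom≡maj r k []          = refl
  majFrom≡maj r k (a ∷ [])    = refl
  majFrom≡maj r k (a ∷ b ∷ w) = cong ((if a >F[ r ] b then k else 0) +_) (majFrom≡maj r (suc k) (b ∷ w))

  invList≡inv : ∀ r w → invList r w ≡ inv (_>F[ r ]_) w
  invList≡inv r []      = refl
  invList≡inv r (a ∷ w) = cong (count (a >F[ r ]_) w +_) (invList≡inv r w)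

  allPairs : ∀ {A : Set} {R : A → A → Set} → (∀ a b → R a b) → ∀ xs → AllPairs R xs
  allPairs r []       = []
  allPairs r (x ∷ xs) = All.universal (r x) xs ∷ allPairs r xs

  module _ {A B : Set} (h : A → B) where

    count-map : ∀ {p : A → Bool} {q : B → Bool} xs → All (λ x → p x ≡ q (h x)) xs →
      count p xs ≡ count q (List.map h xs)
    count-map                 []       []       = refl
    count-map {p = p} {q = q} (x ∷ xs) (e ∷ es) rewrite e with q (h x)
    ... | true  = cong suc (count-map xs es)
    ... | false = count-map xs es

    maj-map : ∀ {f : A → A → Bool} {g : B → B → Bool} k xs →
      AllPairs (λ a b → f a b ≡ g (h a) (h b)) xs → maj f k xs ≡ maj g k (List.map h xs)
    maj-map k []           _              = refl
    maj-map k (a ∷ [])     _              = refl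
    maj-map k (a ∷ b ∷ xs) ((e ∷ _) ∷ es) =
      cong₂ _+_ (cong (λ t → if t then k else 0) e) (maj-map (suc k) (b ∷ xs) es)

    inv-map : ∀ {f : A → A → Bool} {g : B → B → Bool} xs →
      AllPairs (λ a b → f a b ≡ g (h a) (h b)) xs → inv f xs ≡ inv g (List.map h xs)
    inv-map                 []       []       = refl
    inv-map {f = f} {g = g} (a ∷ xs) (e ∷ es) =
      cong₂ _+_ (count-map {p = f a} {q = g (h a)} xs e) (inv-map xs es)

  count-cong : ∀ {A : Set} {p q : A → Bool} xs → (∀ x → p x ≡ q x) → count p xs ≡ count q xs
  count-cong {q = q} xs e = trans (count-map id xs (All.universal e xs)) (cong (count q) (map-id xs))

  module _ {A : Set} (_≻_ : A → A → Bool) where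

    inv-∷ʳ : ∀ xs c → inv _≻_ (xs List.∷ʳ c) ≡ inv _≻_ xs + count (_≻ c) xs
    inv-∷ʳ []       c = refl
    inv-∷ʳ (x ∷ xs) c = begin
      count (x ≻_) (xs List.∷ʳ c) + inv _≻_ (xs List.∷ʳ c)
        ≡⟨ cong₂ _+_ (count-∷ʳ (x ≻_) xs c) (inv-∷ʳ xs c) ⟩
      (count (x ≻_) xs + ⟦ x ≻ c ⟧) + (inv _≻_ xs + count (_≻ c) xs)
        ≡⟨ interchange (count (x ≻_) xs) ⟦ x ≻ c ⟧ (inv _≻_ xs) (count (_≻ c) xs) ⟩
      inv _≻_ (x ∷ xs) + (⟦ x ≻ c ⟧ + count (_≻ c) xs)
        ≡⟨ cong (inv _≻_ (x ∷ xs) +_) (count-∷ (_≻ c) x xs) ⟨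
      inv _≻_ (x ∷ xs) + count (_≻ c) (x ∷ xs) ∎
      where open ≡-Reasoning

    maj-∷ʳ : ∀ k {m} (v : Vec A (suc m)) c →
      maj _≻_ k (Vec.toList (v ∷ʳ c)) ≡ maj _≻_ k (Vec.toList v) + (if Vec.last v ≻ c then k + m else 0)
    maj-∷ʳ k (x ∷ []) c with x ≻ c
    ... | true  = refl
    ... | false = refl
    maj-∷ʳ k {suc m} (x ∷ y ∷ v) c rewrite maj-∷ʳ (suc k) (y ∷ v) c | +-suc k m =
      sym (+-assoc (if x ≻ y then k else 0) _ _)

  elemᵇ-∷-false : ∀ {m k} {a b : Fin m} {σ : Vec (Fin m) k} →
    elemᵇ a (b ∷ σ) ≡ false → toℕ a ≢ toℕ b × elemᵇ a σ ≡ false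
  elemᵇ-∷-false {a = a} {b} e with toℕ a ≡ᵇ toℕ b in eq
  elemᵇ-∷-false () | true
  elemᵇ-∷-false e  | false = ≡ᵇ-false⇒≢ eq , e

  distinct-∷ : ∀ {m k} {b : Fin m} (σ : Vec (Fin m) k) →
    distinctᵇ (b ∷ σ) ≡ true → elemᵇ b σ ≡ false × distinctᵇ σ ≡ true
  distinct-∷ {b = b} σ d with elemᵇ b σ | distinctᵇ σ
  distinct-∷ σ _  | false | true  = refl , refl
  distinct-∷ σ () | true  | _
  distinct-∷ σ () | false | false

  elemᵇ-∷ʳ : ∀ {m k} (b : Fin m) (w : Vec (Fin m) k) a → elemᵇ b (w ∷ʳ a) ≡ (elemᵇ b w ∨ (toℕ b ≡ᵇ toℕ a))
  elemᵇ-∷ʳ b []      a with toℕ b ≡ᵇ toℕ a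
  ... | true  = refl
  ... | false = refl
  elemᵇ-∷ʳ b (c ∷ w) a with toℕ b ≡ᵇ toℕ c
  ... | true  = refl
  ... | false = elemᵇ-∷ʳ b w a

  distinct-∷ʳ : ∀ {m k} (w : Vec (Fin m) k) a → distinctᵇ (w ∷ʳ a) ≡ (distinctᵇ w ∧ not (elemᵇ a w))
  distinct-∷ʳ []      a = refl
  distinct-∷ʳ (b ∷ w) a
    rewrite elemᵇ-∷ʳ b w a | distinct-∷ʳ w a | ≡ᵇ-sym (toℕ a) (toℕ b)
    = regroup (elemᵇ b w) (toℕ b ≡ᵇ toℕ a) (distinctᵇ w) (elemᵇ a w)
    where
    regroup : ∀ x y d e → (not (x ∨ y) ∧ (d ∧ not e)) ≡ ((not x ∧ d) ∧ not (if y then true else e))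
    regroup true  y     d e = refl
    regroup false true  d e = sym (∧-zeroʳ d)
    regroup false false d e = refl

  elemᵇ-map-punchIn : ∀ {m k} (a : Fin (suc m)) (i : Fin m) (σ : Vec (Fin m) k) →
    elemᵇ (punchIn a i) (Vec.map (punchIn a) σ) ≡ elemᵇ i σ
  elemᵇ-map-punchIn a i []      = refl
  elemᵇ-map-punchIn a i (j ∷ σ) rewrite punchIn-≡ᵇ a i j | elemᵇ-map-punchIn a i σ = refl

  distinct-map-punchIn : ∀ {m k} (a : Fin (suc m)) (σ : Vec (Fin m) k) →
    distinctᵇ (Vec.map (punchIn a) σ) ≡ distinctᵇ σ
  distinct-map-punchIn a []      = refl
  distinct-map-punchIn a (i ∷ σ) rewrite elemᵇ-map-punchIn a i σ | distinct-map-punchIn a σ = refl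

  allFin-suc : ∀ m → List.allFin (suc m) ≡ zero ∷ List.map suc (List.allFin m)
  allFin-suc m = cong (zero ∷_) (sym (map-tabulate id suc))

  count-allFin-suc : ∀ {m} (p : Fin (suc m) → Bool) →
    count p (List.allFin (suc m)) ≡ ⟦ p zero ⟧ + count (p ∘ suc) (List.allFin m)
  count-allFin-suc {m} p = begin
    count p (List.allFin (suc m))                        ≡⟨ cong (count p) (allFin-suc m) ⟩
    count p (zero ∷ List.map suc (List.allFin m))        ≡⟨ count-∷ p zero (List.map suc (List.allFin m)) ⟩
    ⟦ p zero ⟧ + count p (List.map suc (List.allFin m))
      ≡⟨ cong (⟦ p zero ⟧ +_) (count-map Fin.suc (List.allFin m) (All.universal (λ _ → refl) _)) ⟨
    ⟦ p zero ⟧ + count (p ∘ suc) (List.allFin m) ∎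
    where open ≡-Reasoning

  count-allFin-remove : ∀ {m} (q : Fin m → Bool) (b : Fin m) →
    count q (List.allFin m) ≡ ⟦ q b ⟧ + count (λ j → q j ∧ not (toℕ j ≡ᵇ toℕ b)) (List.allFin m)
  count-allFin-remove {suc m} q zero =
    trans (count-allFin-suc q) (cong (⟦ q zero ⟧ +_) (sym (begin
      count (λ j → q j ∧ not (toℕ j ≡ᵇ 0)) (List.allFin (suc m))
        ≡⟨ count-allFin-suc {m} (λ j → q j ∧ not (toℕ j ≡ᵇ 0)) ⟩
      ⟦ q zero ∧ false ⟧ + count (λ j → q (suc j) ∧ true) (List.allFin m)
        ≡⟨ cong₂ _+_ (cong ⟦_⟧ (∧-zeroʳ (q zero)))
                     (count-cong (List.allFin m) (λ j → ∧-identityʳ (q (suc j)))) ⟩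
      count (q ∘ suc) (List.allFin m) ∎)))
    where open ≡-Reasoning
  count-allFin-remove {suc m} q (suc b) = begin
    count q (List.allFin (suc m))
      ≡⟨ count-allFin-suc q ⟩
    ⟦ q zero ⟧ + count (q ∘ suc) (List.allFin m)
      ≡⟨ cong (⟦ q zero ⟧ +_) (count-allFin-remove (q ∘ suc) b) ⟩
    ⟦ q zero ⟧ + (⟦ q (suc b) ⟧ + count q′ (List.allFin m))
      ≡⟨ x∙yz≈y∙xz ⟦ q zero ⟧ ⟦ q (suc b) ⟧ (count q′ (List.allFin m)) ⟩
    ⟦ q (suc b) ⟧ + (⟦ q zero ⟧ + count q′ (List.allFin m))
      ≡⟨ cong (λ t → ⟦ q (suc b) ⟧ + (⟦ t ⟧ + count q′ (List.allFin m))) (∧-identityʳ (q zero)) ⟨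
    ⟦ q (suc b) ⟧ + (⟦ q zero ∧ true ⟧ + count q′ (List.allFin m))
      ≡⟨ cong (⟦ q (suc b) ⟧ +_) (count-allFin-suc {m} (λ j → q j ∧ not (toℕ j ≡ᵇ toℕ (suc b)))) ⟨
    ⟦ q (suc b) ⟧ + count (λ j → q j ∧ not (toℕ j ≡ᵇ toℕ (suc b))) (List.allFin (suc m)) ∎
    where
    open ≡-Reasoning
    q′ : Fin m → Bool
    q′ j = q (suc j) ∧ not (toℕ j ≡ᵇ toℕ b)

  count-distinct : ∀ {m k} (σ : Vec (Fin m) k) → distinctᵇ σ ≡ true → ∀ p →
    count p (Vec.toList σ) + count (λ j → p j ∧ not (elemᵇ j σ)) (List.allFin m) ≡ count p (List.allFin m)
  count-distinct {m} [] _ p = count-cong (List.allFin m) (λ j → ∧-identityʳ (p j))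
  count-distinct {m} (b ∷ σ) d p = begin
    count p (b ∷ Vec.toList σ) + count (λ j → p j ∧ not (elemᵇ j (b ∷ σ))) (List.allFin m)
      ≡⟨ cong₂ _+_ (count-∷ p b (Vec.toList σ)) (count-cong (List.allFin m) unfold-elemᵇ) ⟩
    (⟦ p b ⟧ + count p (Vec.toList σ)) + rest
      ≡⟨ cong (λ t → (⟦ t ⟧ + count p (Vec.toList σ)) + rest) qb≡pb ⟨
    (⟦ q b ⟧ + count p (Vec.toList σ)) + rest
      ≡⟨ xy∙z≈y∙xz ⟦ q b ⟧ (count p (Vec.toList σ)) rest ⟩
    count p (Vec.toList σ) + (⟦ q b ⟧ + rest)
      ≡⟨ cong (count p (Vec.toList σ) +_) (count-allFin-remove q b) ⟨
    count p (Vec.toList σ) + count q (List.allFin m)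
      ≡⟨ count-distinct σ (proj₂ b∉σ,σ-distinct) p ⟩
    count p (List.allFin m) ∎
    where
    open ≡-Reasoning
    b∉σ,σ-distinct = distinct-∷ σ d
    q : Fin m → Bool
    q j = p j ∧ not (elemᵇ j σ)
    rest : ℕ
    rest = count (λ j → q j ∧ not (toℕ j ≡ᵇ toℕ b)) (List.allFin m)
    qb≡pb : q b ≡ p b
    qb≡pb = trans (cong (λ e → p b ∧ not e) (proj₁ b∉σ,σ-distinct)) (∧-identityʳ (p b))
    unfold-elemᵇ : ∀ j → (p j ∧ not (elemᵇ j (b ∷ σ))) ≡ (q j ∧ not (toℕ j ≡ᵇ toℕ b))
    unfold-elemᵇ j with toℕ j ≡ᵇ toℕ b
    ... | true  = trans (∧-zeroʳ (p j)) (sym (∧-zeroʳ (q j)))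
    ... | false = sym (∧-identityʳ (q j))

  count-permutation : ∀ {m} (σ : Vec (Fin m) m) → distinctᵇ σ ≡ true → ∀ p →
    count p (Vec.toList σ) ≡ count p (List.allFin m)
  count-permutation {m} σ d p = begin
    count p (Vec.toList σ)                  ≡⟨ +-identityʳ _ ⟨
    count p (Vec.toList σ) + 0              ≡⟨ cong (count p (Vec.toList σ) +_) missed-by-σ ⟨
    count p (Vec.toList σ) + count (λ j → p j ∧ not (elemᵇ j σ)) (List.allFin m)
                                            ≡⟨ count-distinct σ d p ⟩
    count p (List.allFin m) ∎
    where
    open ≡-Reasoning
    -- For p = true, count-distinct says that σ misses no element of Fin m.
    missed : count (λ j → not (elemᵇ j σ)) (List.allFin m) ≡ 0
    missed = +-cancelˡ-≡ m _ 0 (begin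
      m + count (λ j → not (elemᵇ j σ)) (List.allFin m)
        ≡⟨ cong (_+ count (λ j → not (elemᵇ j σ)) (List.allFin m))
                (trans (sym (length-toList σ)) (sym (count-true (Vec.toList σ)))) ⟩
      count (λ _ → true) (Vec.toList σ) + count (λ j → not (elemᵇ j σ)) (List.allFin m)
        ≡⟨ count-distinct σ d (λ _ → true) ⟩
      count (λ _ → true) (List.allFin m) ≡⟨ count-true (List.allFin m) ⟩
      List.length (List.allFin m)         ≡⟨ length-tabulate id ⟩
      m                                   ≡⟨ +-identityʳ m ⟨
      m + 0 ∎)
    missed-by-σ : count (λ j → p j ∧ not (elemᵇ j σ)) (List.allFin m) ≡ 0
    missed-by-σ =
      n≤0⇒n≡0 (≤-trans (count-∧-≤ p (λ j → not (elemᵇ j σ)) (List.allFin m)) (≤-reflexive missed))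

  count-≤ᵇ-allFin : ∀ m k → count (λ j → k ≤ᵇ toℕ j) (List.allFin m) ≡ m ∸ k
  count-≤ᵇ-allFin zero    k       = sym (0∸n≡0 k)
  count-≤ᵇ-allFin (suc m) zero    =
    trans (count-allFin-suc {m} (λ j → 0 ≤ᵇ toℕ j)) (cong suc (count-≤ᵇ-allFin m zero))
  count-≤ᵇ-allFin (suc m) (suc k) =
    trans (count-allFin-suc {m} (λ j → suc k ≤ᵇ toℕ j))
          (trans (count-cong (List.allFin m) (λ j → <ᵇ-suc k (toℕ j))) (count-≤ᵇ-allFin m k))

  -- Statistics of permutations and colored permutations

  invᵛ : ∀ {m k} → Vec (Fin m) k → ℕ
  invᵛ π = inv _>ᶠ_ (Vec.toList π)

  majᵛ : ∀ {m k} → Vec (Fin m) k → ℕ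
  majᵛ π = maj _>ᶠ_ 1 (Vec.toList π)

  withLast : ∀ {m} → Fin (suc m) → Vec (Fin m) m → Vec (Fin (suc m)) (suc m)
  withLast a σ = Vec.map (punchIn a) σ ∷ʳ a

  punchIn-preserves->ᶠ : ∀ {m} (a : Fin (suc m)) (i j : Fin m) → (i >ᶠ j) ≡ (punchIn a i >ᶠ punchIn a j)
  punchIn-preserves->ᶠ a i j = sym (punchIn-<ᵇ a j i)

  inv-map-punchIn : ∀ {m k} (a : Fin (suc m)) (σ : Vec (Fin m) k) → invᵛ (Vec.map (punchIn a) σ) ≡ invᵛ σ
  inv-map-punchIn a σ = trans (cong (inv _>ᶠ_) (toList-map (punchIn a) σ))
    (sym (inv-map (punchIn a) (Vec.toList σ) (allPairs (punchIn-preserves->ᶠ a) _)))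

  maj-map-punchIn : ∀ {m k} (a : Fin (suc m)) (σ : Vec (Fin m) k) → majᵛ (Vec.map (punchIn a) σ) ≡ majᵛ σ
  maj-map-punchIn a σ = trans (cong (maj _>ᶠ_ 1) (toList-map (punchIn a) σ))
    (sym (maj-map (punchIn a) 1 (Vec.toList σ) (allPairs (punchIn-preserves->ᶠ a) _)))

  last-map : ∀ {A B : Set} {m} (f : A → B) (v : Vec A (suc m)) → Vec.last (Vec.map f v) ≡ f (Vec.last v)
  last-map f (x ∷ [])    = refl
  last-map f (x ∷ y ∷ v) = last-map f (y ∷ v)

  inv-withLast : ∀ {m} (a : Fin (suc m)) (σ : Vec (Fin m) m) → distinctᵇ σ ≡ true →
    invᵛ (withLast a σ) ≡ invᵛ σ + (m ∸ toℕ a)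
  inv-withLast {m} a σ d = begin
    inv _>ᶠ_ (Vec.toList (Vec.map (punchIn a) σ ∷ʳ a))
      ≡⟨ cong (inv _>ᶠ_) (toList-∷ʳ a (Vec.map (punchIn a) σ)) ⟩
    inv _>ᶠ_ (Vec.toList (Vec.map (punchIn a) σ) List.∷ʳ a)
      ≡⟨ inv-∷ʳ _>ᶠ_ (Vec.toList (Vec.map (punchIn a) σ)) a ⟩
    invᵛ (Vec.map (punchIn a) σ) + count (_>ᶠ a) (Vec.toList (Vec.map (punchIn a) σ))
      ≡⟨ cong₂ _+_ (inv-map-punchIn a σ) entries-above-a ⟩
    invᵛ σ + count (λ j → toℕ a ≤ᵇ toℕ j) (Vec.toList σ)
      ≡⟨ cong (invᵛ σ +_) (trans (count-permutation σ d _) (count-≤ᵇ-allFin m (toℕ a))) ⟩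
    invᵛ σ + (m ∸ toℕ a) ∎
    where
    open ≡-Reasoning
    entries-above-a :
      count (_>ᶠ a) (Vec.toList (Vec.map (punchIn a) σ)) ≡ count (λ j → toℕ a ≤ᵇ toℕ j) (Vec.toList σ)
    entries-above-a = trans (cong (count (_>ᶠ a)) (toList-map (punchIn a) σ))
      (sym (count-map (punchIn a) (Vec.toList σ) (All.universal (λ j → sym (<ᵇ-punchIn a j)) _)))

  maj-withLast : ∀ {n} (a : Fin (suc (suc n))) (σ : Vec (Fin (suc n)) (suc n)) →
    majᵛ (withLast a σ) ≡ majᵛ σ + (if toℕ a ≤ᵇ toℕ (Vec.last σ) then suc n else 0)
  maj-withLast {n} a σ = begin
    maj _>ᶠ_ 1 (Vec.toList (Vec.map (punchIn a) σ ∷ʳ a))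
      ≡⟨ maj-∷ʳ _>ᶠ_ 1 (Vec.map (punchIn a) σ) a ⟩
    majᵛ (Vec.map (punchIn a) σ) + (if Vec.last (Vec.map (punchIn a) σ) >ᶠ a then suc n else 0)
      ≡⟨ cong₂ _+_ (maj-map-punchIn a σ) (cong (λ t → if t then suc n else 0) last-above-a) ⟩
    majᵛ σ + (if toℕ a ≤ᵇ toℕ (Vec.last σ) then suc n else 0) ∎
    where
    open ≡-Reasoning
    last-above-a : (Vec.last (Vec.map (punchIn a) σ) >ᶠ a) ≡ (toℕ a ≤ᵇ toℕ (Vec.last σ))
    last-above-a = trans (cong (_>ᶠ a) (last-map (punchIn a) σ)) (<ᵇ-punchIn a (Vec.last σ))

  -- word (z , π), with alphabet size and length decoupled so that it can be built by induction.
  letters : ∀ {r m k} → Vec (Fin r) k → Vec (Fin m) k → List Letter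
  letters z π = Vec.toList (Vec.zipWith (λ p c → (toℕ p , toℕ c)) π z)

  map-proj₁-letters : ∀ {r m k} (z : Vec (Fin r) k) (π : Vec (Fin m) k) →
    List.map proj₁ (letters z π) ≡ List.map toℕ (Vec.toList π)
  map-proj₁-letters []      []      = refl
  map-proj₁-letters (c ∷ z) (p ∷ π) = cong (toℕ p ∷_) (map-proj₁-letters z π)

  letters-compare-by-value : ∀ {r m k} (z : Vec (Fin r) k) (π : Vec (Fin m) k) → distinctᵇ π ≡ true →
    AllPairs (λ a b → (a >F[ r ] b) ≡ (proj₁ a >ᵇ proj₁ b)) (letters z π)
  letters-compare-by-value []      []      _ = []
  letters-compare-by-value {r} {m} (c ∷ z) (p ∷ π) d =
    first-compares-by-value z π (proj₁ p∉π,π-distinct)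
      ∷ letters-compare-by-value z π (proj₂ p∉π,π-distinct)
    where
    p∉π,π-distinct = distinct-∷ π d
    first-compares-by-value : ∀ {k} (z : Vec (Fin r) k) (π : Vec (Fin m) k) → elemᵇ p π ≡ false →
      All (λ b → ((toℕ p , toℕ c) >F[ r ] b) ≡ (toℕ p >ᵇ proj₁ b)) (letters z π)
    first-compares-by-value []       []      _   = []
    first-compares-by-value (c′ ∷ z) (q ∷ π) p∉ =
      >F-distinct-values (toℕ<n c) (toℕ<n c′) (proj₁ p≢q,p∉π)
        ∷ first-compares-by-value z π (proj₂ p≢q,p∉π)
      where p≢q,p∉π = elemᵇ-∷-false {a = p} {b = q} {σ = π} p∉

  invF≡invᵛ : ∀ {r n} (z : Vec (Fin r) n) (π : Vec (Fin n) n) → distinctᵇ π ≡ true → invF (z , π) ≡ invᵛ π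
  invF≡invᵛ {r} z π d = begin
    invList r (letters z π)                 ≡⟨ invList≡inv r (letters z π) ⟩
    inv (_>F[ r ]_) (letters z π)           ≡⟨ inv-map proj₁ (letters z π) (letters-compare-by-value z π d) ⟩
    inv _>ᵇ_ (List.map proj₁ (letters z π)) ≡⟨ cong (inv _>ᵇ_) (map-proj₁-letters z π) ⟩
    inv _>ᵇ_ (List.map toℕ (Vec.toList π))  ≡⟨ inv-map toℕ (Vec.toList π) (allPairs (λ _ _ → refl) _) ⟨
    invᵛ π ∎
    where open ≡-Reasoning

  majF≡majᵛ : ∀ {r n} (z : Vec (Fin r) n) (π : Vec (Fin n) n) → distinctᵇ π ≡ true → majF (z , π) ≡ majᵛ π
  majF≡majᵛ {r} z π d = begin
    majFrom r 1 (letters z π)                 ≡⟨ majFrom≡maj r 1 (letters z π) ⟩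
    maj (_>F[ r ]_) 1 (letters z π)           ≡⟨ maj-map proj₁ 1 (letters z π) (letters-compare-by-value z π d) ⟩
    maj _>ᵇ_ 1 (List.map proj₁ (letters z π)) ≡⟨ cong (maj _>ᵇ_ 1) (map-proj₁-letters z π) ⟩
    maj _>ᵇ_ 1 (List.map toℕ (Vec.toList π))  ≡⟨ maj-map toℕ 1 (Vec.toList π) (allPairs (λ _ _ → refl) _) ⟨
    majᵛ π ∎
    where open ≡-Reasoning

  colourSum : ∀ {r L} → Vec (Fin r) L → ℕ
  colourSum z = sum (List.map toℕ (Vec.toList z))

module Sums {c ℓ} (R : CommutativeRing c ℓ) where
  open CommutativeRing R hiding (zero)
  open RingNotions R
  open import Algebra.Properties.Ring ring using (-‿distribˡ-*; -‿distribʳ-*; -‿involutive)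
  open import Algebra.Properties.CommutativeSemigroup *-commutativeSemigroup
    using (interchange; x∙yz≈y∙xz; x∙yz≈xz∙y; x∙yz≈y∙zx)
  open import Algebra.Properties.CommutativeSemigroup +-commutativeSemigroup
    using () renaming (interchange to +-interchange)
  open import Algebra.Properties.CommutativeSemiring.Exp commutativeSemiring
    using (_^_; ^-congˡ; ^-homo-*; ^-assocʳ; ^-distrib-*)
  open import Relation.Binary.Reasoning.Setoid setoid
  import Data.Nat as ℕ
  import Data.Nat.Properties as ℕₚ
  import Relation.Binary.PropositionalEquality as ≡

  ^'≡^ : ∀ x k → x ^' k ≡ x ^ k
  ^'≡^ x zero    = ≡.refl
  ^'≡^ x (suc k) = ≡.cong (x *_) (^'≡^ x k)

  module _ {A : Set} where

    ΣL-cong : ∀ xs {f g : A → Carrier} → (∀ a → f a ≈ g a) → ΣL xs f ≈ ΣL xs g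
    ΣL-cong []       _ = refl
    ΣL-cong (x ∷ xs) e = +-cong (e x) (ΣL-cong xs e)

    ΣL-++ : ∀ xs ys (f : A → Carrier) → ΣL (xs ++ ys) f ≈ ΣL xs f + ΣL ys f
    ΣL-++ []       ys f = sym (+-identityˡ _)
    ΣL-++ (x ∷ xs) ys f = trans (+-congˡ (ΣL-++ xs ys f)) (sym (+-assoc _ _ _))

    ΣL-0# : ∀ xs → ΣL xs (λ (_ : A) → 0#) ≈ 0#
    ΣL-0# []       = refl
    ΣL-0# (x ∷ xs) = trans (+-identityˡ _) (ΣL-0# xs)

    ΣL-+ : ∀ xs (f g : A → Carrier) → ΣL xs (λ a → f a + g a) ≈ ΣL xs f + ΣL xs g
    ΣL-+ []       f g = sym (+-identityˡ 0#)
    ΣL-+ (x ∷ xs) f g = trans (+-congˡ (ΣL-+ xs f g)) (+-interchange _ _ _ _)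

    ΣL-*ˡ : ∀ k xs (f : A → Carrier) → k * ΣL xs f ≈ ΣL xs (λ a → k * f a)
    ΣL-*ˡ k []       f = zeroʳ k
    ΣL-*ˡ k (x ∷ xs) f = trans (distribˡ k _ _) (+-congˡ (ΣL-*ˡ k xs f))

    ΣL-*ʳ : ∀ k xs (f : A → Carrier) → ΣL xs f * k ≈ ΣL xs (λ a → f a * k)
    ΣL-*ʳ k xs f = trans (*-comm _ k) (trans (ΣL-*ˡ k xs f) (ΣL-cong xs (λ a → *-comm k (f a))))

    ΣL-filter : ∀ p xs (f : A → Carrier) → ΣL (boolFilter p xs) f ≈ ΣL xs (λ a → if p a then f a else 0#)
    ΣL-filter p []       f = refl
    ΣL-filter p (x ∷ xs) f with p x
    ... | true  = +-congˡ (ΣL-filter p xs f)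
    ... | false = trans (ΣL-filter p xs f) (sym (+-identityˡ _))

    ΣL-filter-cong : ∀ p xs {f g : A → Carrier} → (∀ a → p a ≡ true → f a ≈ g a) →
      ΣL (boolFilter p xs) f ≈ ΣL (boolFilter p xs) g
    ΣL-filter-cong p []       _ = refl
    ΣL-filter-cong p (x ∷ xs) e with p x in px
    ... | true  = +-cong (e x px) (ΣL-filter-cong p xs e)
    ... | false = ΣL-filter-cong p xs e

  module _ {A B : Set} where

    ΣL-map : ∀ (h : A → B) xs f → ΣL (List.map h xs) f ≡ ΣL xs (f ∘ h)
    ΣL-map h []       f = ≡.refl
    ΣL-map h (x ∷ xs) f = ≡.cong (f (h x) +_) (ΣL-map h xs f)

    ΣL-swap : ∀ xs ys (f : A → B → Carrier) → ΣL xs (λ a → ΣL ys (f a)) ≈ ΣL ys (λ b → ΣL xs (λ a → f a b))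
    ΣL-swap []       ys f = sym (ΣL-0# ys)
    ΣL-swap (x ∷ xs) ys f = trans (+-congˡ (ΣL-swap xs ys f)) (sym (ΣL-+ ys (f x) _))

    ΣL-*-ΣL : ∀ xs ys (f : A → Carrier) (g : B → Carrier) →
      ΣL xs f * ΣL ys g ≈ ΣL xs (λ a → ΣL ys (λ b → f a * g b))
    ΣL-*-ΣL xs ys f g = trans (ΣL-*ʳ (ΣL ys g) xs f) (ΣL-cong xs (λ a → ΣL-*ˡ (f a) ys g))

  ΣL-concatMap-map : ∀ {A B C : Set} (g : A → B → C) xs ys f →
    ΣL (concatMap (λ a → List.map (g a) ys) xs) f ≈ ΣL xs (λ a → ΣL ys (f ∘ g a))
  ΣL-concatMap-map g []       ys f = refl
  ΣL-concatMap-map g (x ∷ xs) ys f =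
    trans (ΣL-++ (List.map (g x) ys) _ f)
          (+-cong (reflexive (ΣL-map (g x) ys f)) (ΣL-concatMap-map g xs ys f))

  ΣL-allFin-suc : ∀ {m} (f : Fin (suc m) → Carrier) →
    ΣL (List.allFin (suc m)) f ≡ f zero + ΣL (List.allFin m) (f ∘ suc)
  ΣL-allFin-suc {m} f =
    ≡.trans (≡.cong (λ xs → ΣL xs f) (allFin-suc m)) (≡.cong (f zero +_) (ΣL-map Fin.suc (List.allFin m) f))

  ΣL-allVecs-∷ : ∀ k L (f : Vec (Fin k) (suc L) → Carrier) →
    ΣL (allVecs k (suc L)) f ≈ ΣL (List.allFin k) (λ a → ΣL (allVecs k L) (λ w → f (a ∷ w)))
  ΣL-allVecs-∷ k L f = ΣL-concatMap-map _∷_ (List.allFin k) (allVecs k L) f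

  ΣL-allVecs-∷ʳ : ∀ k L (f : Vec (Fin k) (suc L) → Carrier) →
    ΣL (allVecs k (suc L)) f ≈ ΣL (allVecs k L) (λ w → ΣL (List.allFin k) (λ a → f (w ∷ʳ a)))
  ΣL-allVecs-∷ʳ k zero f =
    trans (ΣL-allVecs-∷ k zero f) (trans (ΣL-cong (List.allFin k) (λ a → +-identityʳ _)) (sym (+-identityʳ _)))
  ΣL-allVecs-∷ʳ k (suc L) f = begin
    ΣL (allVecs k (suc (suc L))) f
      ≈⟨ ΣL-allVecs-∷ k (suc L) f ⟩
    ΣL (List.allFin k) (λ b → ΣL (allVecs k (suc L)) (λ w → f (b ∷ w)))
      ≈⟨ ΣL-cong (List.allFin k) (λ b → ΣL-allVecs-∷ʳ k L (λ w → f (b ∷ w))) ⟩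
    ΣL (List.allFin k) (λ b → ΣL (allVecs k L) (λ w → ΣL (List.allFin k) (λ a → f (b ∷ (w ∷ʳ a)))))
      ≈⟨ ΣL-allVecs-∷ k L _ ⟨
    ΣL (allVecs k (suc L)) (λ w → ΣL (List.allFin k) (λ a → f (w ∷ʳ a))) ∎

  ΣL-allFin-punchIn : ∀ {m} (a : Fin (suc m)) (f : Fin (suc m) → Carrier) →
    ΣL (List.allFin (suc m)) (λ b → if toℕ a ≡ᵇ toℕ b then 0# else f b) ≈ ΣL (List.allFin m) (f ∘ punchIn a)
  ΣL-allFin-punchIn {m} zero f = trans (reflexive (ΣL-allFin-suc {m} _)) (+-identityˡ _)
  ΣL-allFin-punchIn {suc m} (suc a) f = begin
    ΣL (List.allFin (suc (suc m))) (λ b → if toℕ (suc a) ≡ᵇ toℕ b then 0# else f b)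
      ≡⟨ ΣL-allFin-suc {suc m} _ ⟩
    f zero + ΣL (List.allFin (suc m)) (λ b → if toℕ a ≡ᵇ toℕ b then 0# else f (suc b))
      ≈⟨ +-congˡ (ΣL-allFin-punchIn a (f ∘ suc)) ⟩
    f zero + ΣL (List.allFin m) (f ∘ suc ∘ punchIn a)
      ≡⟨ ΣL-allFin-suc {m} (f ∘ punchIn (suc a)) ⟨
    ΣL (List.allFin (suc m)) (f ∘ punchIn (suc a)) ∎

  ΣL-allVecs-avoid : ∀ {m} L (a : Fin (suc m)) (h : Vec (Fin (suc m)) L → Carrier) →
    ΣL (allVecs (suc m) L) (λ w → if elemᵇ a w then 0# else h w) ≈ ΣL (allVecs m L) (h ∘ Vec.map (punchIn a))
  ΣL-allVecs-avoid zero    a h = refl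
  ΣL-allVecs-avoid {m} (suc L) a h = begin
    ΣL (allVecs (suc m) (suc L)) (λ w → if elemᵇ a w then 0# else h w)
      ≈⟨ ΣL-allVecs-∷ (suc m) L _ ⟩
    ΣL (List.allFin (suc m)) (λ b → ΣL (allVecs (suc m) L) (λ w → if elemᵇ a (b ∷ w) then 0# else h (b ∷ w)))
      ≈⟨ ΣL-cong (List.allFin (suc m)) avoid-tail ⟩
    ΣL (List.allFin (suc m)) (λ b → if toℕ a ≡ᵇ toℕ b then 0# else avoiding b)
      ≈⟨ ΣL-allFin-punchIn a avoiding ⟩
    ΣL (List.allFin m) (λ i → ΣL (allVecs m L) (λ σ → h (punchIn a i ∷ Vec.map (punchIn a) σ)))
      ≈⟨ ΣL-allVecs-∷ m L _ ⟨
    ΣL (allVecs m (suc L)) (h ∘ Vec.map (punchIn a)) ∎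
    where
    avoiding : Fin (suc m) → Carrier
    avoiding b = ΣL (allVecs m L) (λ σ → h (b ∷ Vec.map (punchIn a) σ))
    avoid-tail : ∀ b → ΣL (allVecs (suc m) L) (λ w → if elemᵇ a (b ∷ w) then 0# else h (b ∷ w))
                     ≈ (if toℕ a ≡ᵇ toℕ b then 0# else avoiding b)
    avoid-tail b with toℕ a ≡ᵇ toℕ b
    ... | true  = ΣL-0# (allVecs (suc m) L)
    ... | false = ΣL-allVecs-avoid L a (λ w → h (b ∷ w))

  ΣL-distinct-∷ʳ : ∀ n (a : Fin (suc n)) (f : Vec (Fin (suc n)) (suc n) → Carrier) →
    ΣL (allVecs (suc n) n) (λ w → if distinctᵇ (w ∷ʳ a) then f (w ∷ʳ a) else 0#) ≈ ΣL (Perms n) (f ∘ withLast a)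
  ΣL-distinct-∷ʳ n a f = begin
    ΣL (allVecs (suc n) n) (λ w → if distinctᵇ (w ∷ʳ a) then f (w ∷ʳ a) else 0#)
      ≈⟨ ΣL-cong (allVecs (suc n) n) split-distinct ⟩
    ΣL (allVecs (suc n) n) (λ w → if elemᵇ a w then 0# else (if distinctᵇ w then f (w ∷ʳ a) else 0#))
      ≈⟨ ΣL-allVecs-avoid n a _ ⟩
    ΣL (allVecs n n) (λ σ → if distinctᵇ (Vec.map (punchIn a) σ) then f (withLast a σ) else 0#)
      ≈⟨ ΣL-cong (allVecs n n) (λ σ →
           reflexive (≡.cong (λ t → if t then f (withLast a σ) else 0#) (distinct-map-punchIn a σ))) ⟩
    ΣL (allVecs n n) (λ σ → if distinctᵇ σ then f (withLast a σ) else 0#)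
      ≈⟨ ΣL-filter distinctᵇ (allVecs n n) _ ⟨
    ΣL (Perms n) (f ∘ withLast a) ∎
    where
    split-distinct : ∀ w → (if distinctᵇ (w ∷ʳ a) then f (w ∷ʳ a) else 0#)
                           ≈ (if elemᵇ a w then 0# else (if distinctᵇ w then f (w ∷ʳ a) else 0#))
    split-distinct w rewrite distinct-∷ʳ w a with distinctᵇ w | elemᵇ a w
    ... | true  | true  = refl
    ... | true  | false = refl
    ... | false | true  = refl
    ... | false | false = refl

  ΣL-Perms-suc : ∀ n (f : Vec (Fin (suc n)) (suc n) → Carrier) →
    ΣL (Perms (suc n)) f ≈ ΣL (List.allFin (suc n)) (λ a → ΣL (Perms n) (f ∘ withLast a))
  ΣL-Perms-suc n f = begin
    ΣL (Perms (suc n)) f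
      ≈⟨ ΣL-filter distinctᵇ (allVecs (suc n) (suc n)) f ⟩
    ΣL (allVecs (suc n) (suc n)) (λ v → if distinctᵇ v then f v else 0#)
      ≈⟨ ΣL-allVecs-∷ʳ (suc n) n _ ⟩
    ΣL (allVecs (suc n) n) (λ w → ΣL (List.allFin (suc n)) (λ a → if distinctᵇ (w ∷ʳ a) then f (w ∷ʳ a) else 0#))
      ≈⟨ ΣL-swap (allVecs (suc n) n) (List.allFin (suc n)) _ ⟩
    ΣL (List.allFin (suc n)) (λ a → ΣL (allVecs (suc n) n) (λ w → if distinctᵇ (w ∷ʳ a) then f (w ∷ʳ a) else 0#))
      ≈⟨ ΣL-cong (List.allFin (suc n)) (λ a → ΣL-distinct-∷ʳ n a f) ⟩
    ΣL (List.allFin (suc n)) (λ a → ΣL (Perms n) (f ∘ withLast a)) ∎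

  sgn-+ : ∀ m n → sgn (m ℕ.+ n) ≈ sgn m * sgn n
  sgn-+ zero    n = sym (*-identityˡ _)
  sgn-+ (suc m) n = trans (-‿cong (sgn-+ m n)) (-‿distribˡ-* _ _)

  sgn-^-homo : ∀ y i j m k → sgn (i ℕ.+ j) * y ^ (m ℕ.+ k) ≈ (sgn i * y ^ m) * (sgn j * y ^ k)
  sgn-^-homo y i j m k = trans (*-cong (sgn-+ i j) (^-homo-* y m k)) (interchange _ _ _ _)

  sgn-*-^ : ∀ k u → sgn k * u ^ k ≈ (- u) ^ k
  sgn-*-^ zero    u = *-identityˡ 1#
  sgn-*-^ (suc k) u = begin
    - sgn k * (u * u ^ k)    ≈⟨ -‿distribˡ-* _ _ ⟨
    - (sgn k * (u * u ^ k))  ≈⟨ -‿cong (x∙yz≈y∙xz _ _ _) ⟩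
    - (u * (sgn k * u ^ k))  ≈⟨ -‿distribˡ-* _ _ ⟩
    - u * (sgn k * u ^ k)    ≈⟨ *-congˡ (sgn-*-^ k u) ⟩
    - u * (- u) ^ k          ∎

  sgn-sq : ∀ n → sgn n * sgn n ≈ 1#
  sgn-sq zero    = *-identityˡ 1#
  sgn-sq (suc n) = begin
    - sgn n * - sgn n    ≈⟨ -‿distribˡ-* _ _ ⟨
    - (sgn n * - sgn n)  ≈⟨ -‿cong (-‿distribʳ-* _ _) ⟨
    - - (sgn n * sgn n)  ≈⟨ -‿involutive _ ⟩
    sgn n * sgn n        ≈⟨ sgn-sq n ⟩
    1#                   ∎

  sgn-^-suc : ∀ n → sgn n ^ suc n ≈ 1#
  sgn-^-suc zero          = *-identityˡ 1#
  sgn-^-suc (suc zero)    = trans (*-congˡ (*-identityʳ _)) (sgn-sq 1)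
  sgn-^-suc (suc (suc n)) = begin
    sgn (suc (suc n)) ^ suc (suc (suc n))  ≈⟨ ^-congˡ (suc (suc (suc n))) (-‿involutive (sgn n)) ⟩
    sgn n * (sgn n * sgn n ^ suc n)        ≈⟨ *-assoc _ _ _ ⟨
    (sgn n * sgn n) * sgn n ^ suc n        ≈⟨ *-cong (sgn-sq n) (sgn-^-suc n) ⟩
    1# * 1#                                ≈⟨ *-identityˡ 1# ⟩
    1#                                     ∎

  qint-suc-last : ∀ a u → qint (suc a) u ≈ qint a u + u ^ a
  qint-suc-last zero    u = trans (+-congˡ (zeroʳ u)) (trans (+-identityʳ 1#) (sym (+-identityˡ 1#)))
  qint-suc-last (suc a) u = begin
    1# + u * qint (suc a) u           ≈⟨ +-congˡ (*-congˡ (qint-suc-last a u)) ⟩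
    1# + u * (qint a u + u ^ a)       ≈⟨ +-congˡ (distribˡ u _ _) ⟩
    1# + (u * qint a u + u * u ^ a)   ≈⟨ +-assoc _ _ _ ⟨
    (1# + u * qint a u) + u * u ^ a   ∎

  qint-+ : ∀ a b u → qint (a ℕ.+ b) u ≈ qint a u + u ^ a * qint b u
  qint-+ zero    b u = sym (trans (+-identityˡ _) (*-identityˡ _))
  qint-+ (suc a) b u = begin
    1# + u * qint (a ℕ.+ b) u                      ≈⟨ +-congˡ (*-congˡ (qint-+ a b u)) ⟩
    1# + u * (qint a u + u ^ a * qint b u)         ≈⟨ +-congˡ (distribˡ u _ _) ⟩
    1# + (u * qint a u + u * (u ^ a * qint b u))   ≈⟨ +-assoc _ _ _ ⟨
    (1# + u * qint a u) + u * (u ^ a * qint b u)   ≈⟨ +-congˡ (*-assoc _ _ _) ⟨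
    (1# + u * qint a u) + (u * u ^ a) * qint b u   ∎

  Σ< : ℕ → (ℕ → Carrier) → Carrier
  Σ< zero    F = 0#
  Σ< (suc m) F = F 0 + Σ< m (F ∘ suc)

  Σ<-cong : ∀ m {F G : ℕ → Carrier} → (∀ j → j < m → F j ≈ G j) → Σ< m F ≈ Σ< m G
  Σ<-cong zero    _ = refl
  Σ<-cong (suc m) e = +-cong (e 0 (ℕ.s≤s ℕ.z≤n)) (Σ<-cong m (λ j j<m → e (suc j) (ℕ.s≤s j<m)))

  Σ<-+ : ∀ a b F → Σ< (a ℕ.+ b) F ≈ Σ< a F + Σ< b (λ i → F (a ℕ.+ i))
  Σ<-+ zero    b F = sym (+-identityˡ _)
  Σ<-+ (suc a) b F = trans (+-congˡ (Σ<-+ a b (F ∘ suc))) (sym (+-assoc _ _ _))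

  Σ<-*ˡ : ∀ k m F → k * Σ< m F ≈ Σ< m (λ j → k * F j)
  Σ<-*ˡ k zero    F = zeroʳ k
  Σ<-*ˡ k (suc m) F = trans (distribˡ k _ _) (+-congˡ (Σ<-*ˡ k m (F ∘ suc)))

  ΣL-allFin-toℕ : ∀ m F → ΣL (List.allFin m) (F ∘ toℕ) ≡ Σ< m F
  ΣL-allFin-toℕ zero    F = ≡.refl
  ΣL-allFin-toℕ (suc m) F = ≡.trans (ΣL-allFin-suc {m} (F ∘ toℕ)) (≡.cong (F 0 +_) (ΣL-allFin-toℕ m (F ∘ suc)))

  Σ<-geometric : ∀ m u → Σ< m (u ^_) ≈ qint m u
  Σ<-geometric zero    u = refl
  Σ<-geometric (suc m) u = +-congˡ (trans (sym (Σ<-*ˡ u m (u ^_))) (*-congˡ (Σ<-geometric m u)))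

  Σ<-geometric-reversed : ∀ m u → Σ< m (λ j → u ^ (m ∸ suc j)) ≈ qint m u
  Σ<-geometric-reversed zero    u = refl
  Σ<-geometric-reversed (suc m) u = begin
    u ^ m + Σ< m (λ j → u ^ (m ∸ suc j))  ≈⟨ +-congˡ (Σ<-geometric-reversed m u) ⟩
    u ^ m + qint m u                      ≈⟨ +-comm _ _ ⟩
    qint m u + u ^ m                      ≈⟨ qint-suc-last m u ⟨
    qint (suc m) u                        ∎

  -- The exponents M·[a ≤ j] + (M - 1 - j) run through b, …, b + M - 1.
  Σ<-rotated-geometric : ∀ u {a b M} → a ℕ.+ b ≡ M →
    Σ< M (λ j → u ^ (if a ≤ᵇ j then M else 0) * u ^ (M ∸ suc j)) ≈ u ^ b * qint M u
  Σ<-rotated-geometric u {a} {b} ≡.refl = begin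
    Σ< (a ℕ.+ b) F                                 ≈⟨ Σ<-+ a b F ⟩
    Σ< a F + Σ< b (λ i → F (a ℕ.+ i))              ≈⟨ +-cong below-a from-a ⟩
    u ^ b * qint a u + u ^ (a ℕ.+ b) * qint b u    ≈⟨ +-congˡ (*-congʳ (trans (^-homo-* u a b) (*-comm _ _))) ⟩
    u ^ b * qint a u + (u ^ b * u ^ a) * qint b u  ≈⟨ +-congˡ (*-assoc _ _ _) ⟩
    u ^ b * qint a u + u ^ b * (u ^ a * qint b u)  ≈⟨ distribˡ _ _ _ ⟨
    u ^ b * (qint a u + u ^ a * qint b u)          ≈⟨ *-congˡ (qint-+ a b u) ⟨
    u ^ b * qint (a ℕ.+ b) u                       ∎
    where
    F : ℕ → Carrier
    F j = u ^ (if a ≤ᵇ j then a ℕ.+ b else 0) * u ^ (a ℕ.+ b ∸ suc j)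

    term-below-a : ∀ j → j < a → F j ≈ u ^ b * u ^ (a ∸ suc j)
    term-below-a j j<a = begin
      F j                           ≡⟨ ≡.cong₂ (λ t k → u ^ (if t then a ℕ.+ b else 0) * u ^ k) (≤ᵇ-false j<a) exponent ⟩
      1# * u ^ (b ℕ.+ (a ∸ suc j))  ≈⟨ *-identityˡ _ ⟩
      u ^ (b ℕ.+ (a ∸ suc j))       ≈⟨ ^-homo-* u b _ ⟩
      u ^ b * u ^ (a ∸ suc j)       ∎
      where
      exponent : a ℕ.+ b ∸ suc j ≡ b ℕ.+ (a ∸ suc j)
      exponent = ≡.trans (ℕₚ.+-∸-comm b j<a) (ℕₚ.+-comm (a ∸ suc j) b)

    term-from-a : ∀ i → F (a ℕ.+ i) ≡ u ^ (a ℕ.+ b) * u ^ (b ∸ suc i)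
    term-from-a i = ≡.cong₂ (λ t k → u ^ (if t then a ℕ.+ b else 0) * u ^ k) (≤ᵇ-true (ℕₚ.m≤m+n a i)) exponent
      where
      exponent : a ℕ.+ b ∸ suc (a ℕ.+ i) ≡ b ∸ suc i
      exponent = ≡.trans (≡.cong (a ℕ.+ b ∸_) (≡.sym (ℕₚ.+-suc a i))) (ℕₚ.[m+n]∸[m+o]≡n∸o a b (suc i))

    below-a : Σ< a F ≈ u ^ b * qint a u
    below-a = begin
      Σ< a F                                ≈⟨ Σ<-cong a term-below-a ⟩
      Σ< a (λ j → u ^ b * u ^ (a ∸ suc j))  ≈⟨ Σ<-*ˡ (u ^ b) a _ ⟨
      u ^ b * Σ< a (λ j → u ^ (a ∸ suc j))  ≈⟨ *-congˡ (Σ<-geometric-reversed a u) ⟩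
      u ^ b * qint a u                      ∎

    from-a : Σ< b (λ i → F (a ℕ.+ i)) ≈ u ^ (a ℕ.+ b) * qint b u
    from-a = begin
      Σ< b (λ i → F (a ℕ.+ i))                      ≈⟨ Σ<-cong b (λ i _ → reflexive (term-from-a i)) ⟩
      Σ< b (λ i → u ^ (a ℕ.+ b) * u ^ (b ∸ suc i))  ≈⟨ Σ<-*ˡ (u ^ (a ℕ.+ b)) b _ ⟨
      u ^ (a ℕ.+ b) * Σ< b (λ i → u ^ (b ∸ suc i))  ≈⟨ *-congˡ (Σ<-geometric-reversed b u) ⟩
      u ^ (a ℕ.+ b) * qint b u                      ∎

  ΣL-allVecs-colourSum : ∀ r L y → ΣL (allVecs r L) (λ z → y ^ colourSum z) ≈ qint r y ^ L
  ΣL-allVecs-colourSum r zero    y = +-identityʳ 1#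
  ΣL-allVecs-colourSum r (suc L) y = begin
    ΣL (allVecs r (suc L)) (λ z → y ^ colourSum z)
      ≈⟨ ΣL-allVecs-∷ r L _ ⟩
    ΣL (List.allFin r) (λ a → ΣL (allVecs r L) (λ z → y ^ (toℕ a ℕ.+ colourSum z)))
      ≈⟨ ΣL-cong (List.allFin r) (λ a → ΣL-cong (allVecs r L) (λ z → ^-homo-* y (toℕ a) (colourSum z))) ⟩
    ΣL (List.allFin r) (λ a → ΣL (allVecs r L) (λ z → y ^ toℕ a * y ^ colourSum z))
      ≈⟨ ΣL-*-ΣL (List.allFin r) (allVecs r L) _ _ ⟨
    ΣL (List.allFin r) (λ a → y ^ toℕ a) * ΣL (allVecs r L) (λ z → y ^ colourSum z)
      ≈⟨ *-cong (trans (reflexive (ΣL-allFin-toℕ r (y ^_))) (Σ<-geometric r y)) (ΣL-allVecs-colourSum r L y) ⟩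
    qint r y * qint r y ^ L ∎

  -- The signed Mahonian distribution

  module _ (x : Carrier) where

    weight : ∀ {m k} → Vec (Fin m) k → Carrier
    weight π = sgn (invᵛ π) * x ^ majᵛ π

    ±x : ℕ → Carrier
    ±x n = sgn n * x

    ±x-^-suc : ∀ n → ±x n ^ suc n ≈ x ^ suc n
    ±x-^-suc n = trans (^-distrib-* (sgn n) x (suc n)) (trans (*-congʳ (sgn-^-suc n)) (*-identityˡ _))

    weight-withLast : ∀ {n} (a : Fin (suc (suc n))) (σ : Vec (Fin (suc n)) (suc n)) → distinctᵇ σ ≡ true →
      weight (withLast a σ)
        ≈ sgn (suc n ∸ toℕ a) * (x ^ (if toℕ a ≤ᵇ toℕ (Vec.last σ) then suc n else 0) * weight σ)
    weight-withLast {n} a σ d = begin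
      sgn (invᵛ (withLast a σ)) * x ^ majᵛ (withLast a σ)
        ≡⟨ ≡.cong₂ (λ i m → sgn i * x ^ m) (inv-withLast a σ d) (maj-withLast a σ) ⟩
      sgn (invᵛ σ ℕ.+ s) * x ^ (majᵛ σ ℕ.+ e)
        ≈⟨ sgn-^-homo x (invᵛ σ) s (majᵛ σ) e ⟩
      weight σ * (sgn s * x ^ e)
        ≈⟨ x∙yz≈y∙zx _ _ _ ⟩
      sgn s * (x ^ e * weight σ) ∎
      where
      s = suc n ∸ toℕ a
      e = if toℕ a ≤ᵇ toℕ (Vec.last σ) then suc n else 0

    ΣL-descent-weights : ∀ n (a : Fin (suc (suc n))) →
      ΣL (List.allFin (suc n)) (λ j → x ^ (if toℕ a ≤ᵇ toℕ j then suc n else 0) * ±x n ^ (n ∸ toℕ j))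
        ≈ ±x n ^ (suc n ∸ toℕ a) * qint (suc n) (±x n)
    ΣL-descent-weights n a = begin
      ΣL (List.allFin (suc n)) (λ j → x ^ (if toℕ a ≤ᵇ toℕ j then suc n else 0) * ±x n ^ (n ∸ toℕ j))
        ≈⟨ ΣL-cong (List.allFin (suc n)) (λ j → *-congʳ (^-descent (toℕ a ≤ᵇ toℕ j))) ⟩
      ΣL (List.allFin (suc n)) (F ∘ toℕ)
        ≡⟨ ΣL-allFin-toℕ (suc n) F ⟩
      Σ< (suc n) F
        ≈⟨ Σ<-rotated-geometric (±x n) {toℕ a} {suc n ∸ toℕ a} (ℕₚ.m+[n∸m]≡n (toℕ≤pred[n] a)) ⟩
      ±x n ^ (suc n ∸ toℕ a) * qint (suc n) (±x n) ∎
      where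
      F : ℕ → Carrier
      F j = ±x n ^ (if toℕ a ≤ᵇ j then suc n else 0) * ±x n ^ (suc n ∸ suc j)
      ^-descent : ∀ t → x ^ (if t then suc n else 0) ≈ ±x n ^ (if t then suc n else 0)
      ^-descent true  = sym (±x-^-suc n)
      ^-descent false = refl

    ΣL-Perms-by-last : ∀ n (g : Fin (suc n) → Carrier) →
      ΣL (Perms (suc n)) (λ σ → g (Vec.last σ) * weight σ)
        ≈ qfact± n x * ΣL (List.allFin (suc n)) (λ j → g j * ±x n ^ (n ∸ toℕ j))
    ΣL-Perms-by-last zero g = begin
      g zero * (1# * 1#) + 0#   ≈⟨ +-identityʳ _ ⟩
      g zero * (1# * 1#)        ≈⟨ *-congˡ (*-identityˡ 1#) ⟩
      g zero * 1#               ≈⟨ *-identityˡ _ ⟨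
      1# * (g zero * 1#)        ≈⟨ *-congˡ (+-identityʳ _) ⟨
      1# * (g zero * 1# + 0#)   ∎
    ΣL-Perms-by-last (suc n) g = begin
      ΣL (Perms (suc N)) (λ π → g (Vec.last π) * weight π)
        ≈⟨ ΣL-Perms-suc N _ ⟩
      ΣL (List.allFin (suc N)) (λ a → ΣL (Perms N) (λ σ → g (Vec.last (withLast a σ)) * weight (withLast a σ)))
        ≈⟨ ΣL-cong (List.allFin (suc N)) (λ a → ΣL-filter-cong distinctᵇ (allVecs N N) (last-letter a)) ⟩
      ΣL (List.allFin (suc N)) (λ a → ΣL (Perms N) (λ σ → (g a * S a) * (descent a (Vec.last σ) * weight σ)))
        ≈⟨ ΣL-cong (List.allFin (suc N)) (λ a → ΣL-*ˡ (g a * S a) (Perms N) _) ⟨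
      ΣL (List.allFin (suc N)) (λ a → (g a * S a) * ΣL (Perms N) (λ σ → descent a (Vec.last σ) * weight σ))
        ≈⟨ ΣL-cong (List.allFin (suc N)) (λ a → *-congˡ
             (trans (ΣL-Perms-by-last n (descent a)) (*-congˡ (ΣL-descent-weights n a)))) ⟩
      ΣL (List.allFin (suc N)) (λ a → (g a * S a) * (qfact± n x * (±x n ^ (N ∸ toℕ a) * qint N (±x n))))
        ≈⟨ ΣL-cong (List.allFin (suc N)) regroup ⟩
      ΣL (List.allFin (suc N)) (λ a → qfact± N x * (g a * ±x N ^ (N ∸ toℕ a)))
        ≈⟨ ΣL-*ˡ (qfact± N x) (List.allFin (suc N)) _ ⟨
      qfact± N x * ΣL (List.allFin (suc N)) (λ a → g a * ±x N ^ (N ∸ toℕ a)) ∎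
      where
      N = suc n
      S : Fin (suc N) → Carrier
      S a = sgn (N ∸ toℕ a)
      descent : Fin (suc N) → Fin N → Carrier
      descent a j = x ^ (if toℕ a ≤ᵇ toℕ j then N else 0)
      last-letter : ∀ a σ → distinctᵇ σ ≡ true →
        g (Vec.last (withLast a σ)) * weight (withLast a σ) ≈ (g a * S a) * (descent a (Vec.last σ) * weight σ)
      last-letter a σ d = begin
        g (Vec.last (withLast a σ)) * weight (withLast a σ)
          ≈⟨ *-cong (reflexive (≡.cong g (last-∷ʳ a (Vec.map (punchIn a) σ)))) (weight-withLast a σ d) ⟩
        g a * (S a * (descent a (Vec.last σ) * weight σ))
          ≈⟨ *-assoc _ _ _ ⟨
        (g a * S a) * (descent a (Vec.last σ) * weight σ) ∎
      regroup : ∀ a → (g a * S a) * (qfact± n x * (±x n ^ (N ∸ toℕ a) * qint N (±x n)))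
                      ≈ qfact± N x * (g a * ±x N ^ (N ∸ toℕ a))
      regroup a = begin
        (g a * S a) * (qfact± n x * (±x n ^ (N ∸ toℕ a) * qint N (±x n)))
          ≈⟨ *-congˡ (x∙yz≈xz∙y _ _ _) ⟩
        (g a * S a) * (qfact± N x * ±x n ^ (N ∸ toℕ a))
          ≈⟨ x∙yz≈y∙xz _ _ _ ⟩
        qfact± N x * ((g a * S a) * ±x n ^ (N ∸ toℕ a))
          ≈⟨ *-congˡ (*-assoc _ _ _) ⟩
        qfact± N x * (g a * (S a * ±x n ^ (N ∸ toℕ a)))
          ≈⟨ *-congˡ (*-congˡ (trans (sgn-*-^ (N ∸ toℕ a) (±x n))
                                     (^-congˡ (N ∸ toℕ a) (-‿distribˡ-* (sgn n) x)))) ⟩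
        qfact± N x * (g a * ±x N ^ (N ∸ toℕ a)) ∎

    ΣL-Perms-weight : ∀ n → ΣL (Perms n) weight ≈ qfact± n x
    ΣL-Perms-weight zero    = trans (+-identityʳ _) (*-identityˡ 1#)
    ΣL-Perms-weight (suc n) = begin
      ΣL (Perms (suc n)) weight
        ≈⟨ ΣL-cong (Perms (suc n)) (λ σ → *-identityˡ (weight σ)) ⟨
      ΣL (Perms (suc n)) (λ σ → 1# * weight σ)
        ≈⟨ ΣL-Perms-by-last n (λ _ → 1#) ⟩
      qfact± n x * ΣL (List.allFin (suc n)) (λ j → 1# * ±x n ^ (n ∸ toℕ j))
        ≈⟨ *-congˡ (ΣL-cong (List.allFin (suc n)) (λ j → *-identityˡ _)) ⟩
      qfact± n x * ΣL (List.allFin (suc n)) (λ j → ±x n ^ (n ∸ toℕ j))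
        ≡⟨ ≡.cong (qfact± n x *_) (ΣL-allFin-toℕ (suc n) (λ j → ±x n ^ (suc n ∸ suc j))) ⟩
      qfact± n x * Σ< (suc n) (λ j → ±x n ^ (suc n ∸ suc j))
        ≈⟨ *-congˡ (Σ<-geometric-reversed (suc n) (±x n)) ⟩
      qfact± (suc n) x ∎

  summand-factorises : ∀ {r n} q (z : Vec (Fin r) n) (π : Vec (Fin n) n) → distinctᵇ π ≡ true →
    csignF (z , π) * q ^' flagMajorF (z , π) ≈ (- q) ^ colourSum z * weight (q ^ r) π
  summand-factorises {r} q z π d = begin
    sgn (invF (z , π) ℕ.+ cs) * q ^' (r ℕ.* majF (z , π) ℕ.+ cs)
      ≡⟨ ≡.cong₂ (λ i k → sgn (i ℕ.+ cs) * k) (invF≡invᵛ z π d)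
                 (≡.trans (^'≡^ q (r ℕ.* majF (z , π) ℕ.+ cs))
                          (≡.cong (λ m → q ^ (r ℕ.* m ℕ.+ cs)) (majF≡majᵛ z π d))) ⟩
    sgn (invᵛ π ℕ.+ cs) * q ^ (r ℕ.* majᵛ π ℕ.+ cs)
      ≈⟨ sgn-^-homo q (invᵛ π) cs (r ℕ.* majᵛ π) cs ⟩
    (sgn (invᵛ π) * q ^ (r ℕ.* majᵛ π)) * (sgn cs * q ^ cs)
      ≈⟨ *-cong (*-congˡ (sym (^-assocʳ q r (majᵛ π)))) (sgn-*-^ cs q) ⟩
    weight (q ^ r) π * (- q) ^ cs
      ≈⟨ *-comm _ _ ⟩
    (- q) ^ cs * weight (q ^ r) π ∎
    where
    cs = colourSum z

mainTheorem9 : {c ℓ : Level} (R : CommutativeRing c ℓ) (r n : ℕ) → 1 ≤ r → 1 ≤ n →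
    (q : CommutativeRing.Carrier R) →
    CommutativeRing._≈_ R (RingNotions.LHS R r n q) (RingNotions.RHS R r n q)
mainTheorem9 R r n _ _ q = begin
  ΣL (G r n) (λ g → csignF g * q ^' flagMajorF g)
    ≈⟨ ΣL-concatMap-map _,_ (allVecs r n) (Perms n) _ ⟩
  ΣL (allVecs r n) (λ z → ΣL (Perms n) (λ π → csignF (z , π) * q ^' flagMajorF (z , π)))
    ≈⟨ ΣL-cong (allVecs r n) (λ z → ΣL-filter-cong distinctᵇ (allVecs n n) (summand-factorises q z)) ⟩
  ΣL (allVecs r n) (λ z → ΣL (Perms n) (λ π → (- q) ^ colourSum z * weight (q ^ r) π))
    ≈⟨ ΣL-*-ΣL (allVecs r n) (Perms n) _ _ ⟨
  ΣL (allVecs r n) (λ z → (- q) ^ colourSum z) * ΣL (Perms n) (weight (q ^ r))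
    ≈⟨ *-cong (ΣL-allVecs-colourSum r n (- q)) (ΣL-Perms-weight (q ^ r) n) ⟩
  qint r (- q) ^ n * qfact± n (q ^ r)
    ≡⟨ ≡.cong₂ (λ y x → y * qfact± n x) (≡.sym (^'≡^ (qint r (- q)) n)) (≡.sym (^'≡^ q r)) ⟩
  qint r (- q) ^' n * qfact± n (q ^' r) ∎
  where
  open CommutativeRing R
  open RingNotions R
  open Sums R
  open import Algebra.Properties.CommutativeSemiring.Exp commutativeSemiring using (_^_)
  open import Relation.Binary.Reasoning.Setoid setoid
  import Relation.Binary.PropositionalEquality as ≡
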